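{- In the vertex-query model, any player strategy that always produces a maximum matching (i.e., a perfect matching of the oracle's graph) requires at least $n/2$ queries on some input graph on $n$ vertices ($n$ even), even when the input graphs are restricted to be bipartite and the oracle is streaming-consistent.
   Context: Vertex-query model: a player and an oracle play a round-based game on a vertex set $V$ with $|V| = n$, known to both. Over the game the oracle makes up a graph $G = (V,E)$ which must admit a perfect matching. In each round $i$ the player, possibly depending on all previous answers, submits a query $V_i \subseteq V$, and the oracle returns a set of edges $M_i$ that is a maximal matching in the vertex-induced subgraph $G[V_i]$; all answers must be consistent with the single graph $G$. After the last round the player reports a maximum matching among the edges $\bigcup_i M_i$. The oracle is streaming-consistent if there is an ordering $\pi$ of $E$ such that for every round $i$, $M_i$ equals the output of the Greedy algorithm (scan edges in order, add an edge whenever both endpoints are currently unmatched) run on the substream of $\pi$ consisting of the edges of $G[V_i]$. -}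

module Defs where

open import Data.Nat using (ℕ; zero; suc; _≤_)
open import Data.Bool using (Bool; true; false; if_then_else_; _∧_; not)
open import Data.Fin using (Fin)
open import Data.Vec using (Vec; lookup; _[_]≔_; replicate)
open import Data.List using (List; []; _∷_; _++_; [_]; length; concatMap)
open import Data.List.Relation.Unary.All using (All)
open import Data.List.Relation.Unary.Any using (Any)
open import Data.List.Relation.Unary.AllPairs using (AllPairs)
open import Data.List.Membership.Propositional using (_∈_)
open import Data.Maybe using (Maybe; just; nothing; maybe)
open import Data.Product using (Σ; _×_; _,_; proj₁; proj₂; ∃)
open import Data.Sum using (_⊎_)
open import Relation.Binary.PropositionalEquality using (_≡_; _≢_)
open import Relation.Nullary using (¬_)

-- Vertex set V = Fin n.  An edge is stored as an (oriented) pair of vertices;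
-- it denotes the unordered pair {u , v}.
Edge : ℕ → Set
Edge n = Fin n × Fin n

SameEdge : ∀ {n} → Edge n → Edge n → Set
SameEdge (u , v) (u' , v') = (u ≡ u' × v ≡ v') ⊎ (u ≡ v' × v ≡ u')

Incident : ∀ {n} → Fin n → Edge n → Set
Incident w (u , v) = (w ≡ u) ⊎ (w ≡ v)

Disjoint : ∀ {n} → Edge n → Edge n → Set
Disjoint e f = ∀ w → Incident w e → ¬ Incident w f

-- The input: a simple graph G = (V,E) together with an ordering π of E,
-- given as a list of edges: no loops, no edge listed twice.
SimpleEdgeList : ∀ {n} → List (Edge n) → Set
SimpleEdgeList π = All (λ e → proj₁ e ≢ proj₂ e) π × AllPairs (λ e f → ¬ SameEdge e f) π

Bipartite : ∀ {n} → List (Edge n) → Set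
Bipartite {n} π = Σ (Fin n → Bool) λ c → All (λ e → c (proj₁ e) ≢ c (proj₂ e)) π

PerfectMatching : ∀ n → List (Edge n) → Set
PerfectMatching n M = AllPairs Disjoint M × (∀ (w : Fin n) → Any (Incident w) M)

ContainsPM : ∀ n → List (Edge n) → Set
ContainsPM n F = Σ (List (Edge n)) λ M → All (_∈ F) M × PerfectMatching n M

-- A query is a vertex subset V_i ⊆ V (characteristic vector).
Query : ℕ → Set
Query n = Vec Bool n

induced : ∀ {n} → Query n → List (Edge n) → List (Edge n)
induced q [] = []
induced q ((u , v) ∷ es) =
  if lookup q u ∧ lookup q v then (u , v) ∷ induced q es else induced q es

-- Greedy on a stream; the vector records the currently matched vertices.
greedyFrom : ∀ {n} → Vec Bool n → List (Edge n) → List (Edge n)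
greedyFrom matched [] = []
greedyFrom matched ((u , v) ∷ es) =
  if not (lookup matched u) ∧ not (lookup matched v)
  then (u , v) ∷ greedyFrom ((matched [ u ]≔ true) [ v ]≔ true) es
  else greedyFrom matched es

greedy : ∀ {n} → List (Edge n) → List (Edge n)
greedy {n} = greedyFrom (replicate n false)

-- The streaming-consistent oracle determined by the ordering π.
answer : ∀ {n} → List (Edge n) → Query n → List (Edge n)
answer π q = greedy (induced q π)

History : ℕ → Set
History n = List (Query n × List (Edge n))

-- A (deterministic, adaptive) player strategy: given the transcript so far,
-- either submit a next query (just q) or stop (nothing).
Strategy : ℕ → Set
Strategy n = History n → Maybe (Query n)

-- Transcript after at most k rounds (stays fixed once the player stops).
transcript : ∀ {n} → Strategy n → List (Edge n) → ℕ → History n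
transcript σ π zero = []
transcript σ π (suc k) =
  maybe (λ q → h ++ [ (q , answer π q) ]) h (σ h)
  where h = transcript σ π k

HaltsBy : ∀ {n} → Strategy n → List (Edge n) → ℕ → Set
HaltsBy σ π k = σ (transcript σ π k) ≡ nothing

answeredEdges : ∀ {n} → History n → List (Edge n)
answeredEdges = concatMap proj₂

Admissible : ∀ n → List (Edge n) → Set
Admissible n π = SimpleEdgeList π × Bipartite π × ContainsPM n π

-- The strategy always produces a perfect matching: on every admissible input
-- it stops, and the union of the returned edges contains a perfect matching
-- (so the maximum matching the player reports among them is perfect).
AlwaysCorrect : ∀ n → Strategy n → Set
AlwaysCorrect n σ = ∀ π → Admissible n π →
  ∃ λ k → HaltsBy σ π k × ContainsPM n (answeredEdges (transcript σ π k))

-- The hard input is the half graph on vertices left i, right i (i < m = n/2), with edges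
-- (left i , right j) for j ≤ i, streamed with all lower edges (j < i) before the diagonal.
-- Its only perfect matching is the diagonal. If the answer to a query contained two diagonal
-- edges i < j, the query would also induce the lower edge (left j , right i), which greedy
-- scans first and which leaves left j or right i matched. So every answer reveals at most one
-- of the m diagonal edges, and a correct player needs m rounds.

module Submission where

open import Defs
open import Data.Nat using (ℕ; _≤_)
open import Data.Nat.DivMod using (_/_)
open import Data.Nat.Divisibility using (_∣_)
open import Data.List using (List; length)
open import Data.Product using (Σ; _×_)

open import Data.Nat using (zero; suc; _+_; _∸_; _*_; _≡ᵇ_)
open import Data.Nat.Properties using (≤-total; m∸n+n≡m; module ≤-Reasoning)
open import Data.Nat.Divisibility using (divides)
open import Data.Nat.DivMod using (m*n/n≡m)
open import Data.Bool using (Bool; true; false; if_then_else_; _∧_; not)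
open import Data.Bool.Properties using (not-¬)
open import Data.Fin as Fin using (Fin; combine; remQuot; toℕ)
open import Data.Fin.Properties using (_<?_; <-cmp; <-irrefl; combine-injectiveˡ; combine-remQuot; remQuot-combine; injective⇒≤)
open import Data.Fin.Induction using (<-wellFounded)
open import Data.Vec using (Vec; lookup; _[_]≔_; replicate)
open import Data.Vec.Properties using (lookup∘update; lookup∘update′)
open import Data.List as List using ([]; _∷_; _++_; [_]; map; filter; cartesianProduct; allFin; concatMap)
open import Data.List.Properties using (map-++)
open import Data.List.Relation.Unary.All as All using (All; []; _∷_)
open import Data.List.Relation.Unary.All.Properties as All using ()
open import Data.List.Relation.Unary.Any as Any using (Any; here; there)
open import Data.List.Relation.Unary.Any.Properties using (lookup-index)
open import Data.List.Relation.Unary.AllPairs as AllPairs using (AllPairs; _∷_)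
import Data.List.Relation.Unary.AllPairs.Properties as AllPairs
open import Data.List.Relation.Unary.Unique.Propositional using (Unique)
import Data.List.Relation.Unary.Unique.Propositional.Properties as Unique
open import Data.List.Membership.Propositional using (_∈_; find; lose)
open import Data.List.Membership.Propositional.Properties
  using (∈-map⁺; ∈-map⁻; ∈-++⁺ʳ; ∈-++⁻; ∈-filter⁺; ∈-filter⁻; ∈-cartesianProduct⁺; ∈-allFin; ∈-concatMap⁻; ∈-lookup)
open import Data.Maybe using (just; nothing; maybe)
open import Data.Product using (_,_; proj₁; proj₂; ∃; ∃₂)
open import Data.Sum using (_⊎_; inj₁; inj₂)
open import Data.Empty using (⊥; ⊥-elim)
open import Function using (_∘_)
open import Function.Definitions using (Injective)
open import Induction.WellFounded using (Acc; acc)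
open import Relation.Binary.Definitions using (Symmetric; tri<; tri≈; tri>)
open import Relation.Binary.PropositionalEquality using (_≡_; _≢_; refl; sym; trans; cong; subst)
open import Relation.Nullary using (¬_; Dec; yes; no)

Disjoint-sym : ∀ {n} → Symmetric (Disjoint {n})
Disjoint-sym apart w w∈f w∈e = apart w w∈e w∈f

allPairs-∈ : ∀ {A : Set} {R : A → A → Set} {x y : A} {xs : List A} → Symmetric R →
  AllPairs R xs → x ∈ xs → y ∈ xs → x ≡ y ⊎ R x y
allPairs-∈ R-sym (_ ∷ _)  (here refl) (here refl) = inj₁ refl
allPairs-∈ R-sym (rs ∷ _) (here refl) (there y∈)  = inj₂ (All.lookup rs y∈)
allPairs-∈ R-sym (rs ∷ _) (there x∈)  (here refl) = inj₂ (R-sym (All.lookup rs x∈))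
allPairs-∈ R-sym (_ ∷ rs) (there x∈)  (there y∈)  = allPairs-∈ R-sym rs x∈ y∈

≤-length-concatMap : ∀ {X B : Set} {m} (f : X → List B) (xs : List X) (e : Fin m → B) →
  (∀ i → e i ∈ concatMap f xs) →
  (∀ {x} → x ∈ xs → ∀ i j → e i ∈ f x → e j ∈ f x → i ≡ j) →
  m ≤ length xs
≤-length-concatMap {m = m} f xs e covered separated = injective⇒≤ round-injective
  where
  round : Fin m → Fin (length xs)
  round i = Any.index (∈-concatMap⁻ f {xs = xs} (covered i))

  in-round : ∀ i → e i ∈ f (List.lookup xs (round i))
  in-round i = lookup-index (∈-concatMap⁻ f {xs = xs} (covered i))

  round-injective : Injective _≡_ _≡_ round
  round-injective {i} {j} same = separated (∈-lookup {xs = xs} (round i)) i j (in-round i)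
    (subst (λ r → e j ∈ f (List.lookup xs r)) (sym same) (in-round j))

Matched Free : ∀ {n} → Vec Bool n → Fin n → Set
Matched s w = lookup s w ≡ true
Free s w = lookup s w ≡ false

mark : ∀ {n} → Fin n → Fin n → Vec Bool n → Vec Bool n
mark u v s = (s [ u ]≔ true) [ v ]≔ true

[]≔true-mono : ∀ {n} (s : Vec Bool n) i w → Matched s w → Matched (s [ i ]≔ true) w
[]≔true-mono s i w matched with i Fin.≟ w
... | yes refl = lookup∘update i s true
... | no i≢w = trans (lookup∘update′ (i≢w ∘ sym) s true) matched

[]≔true-free⁻ : ∀ {n} (s : Vec Bool n) i w → Free (s [ i ]≔ true) w → Free s w
[]≔true-free⁻ s i w free with lookup s w in eq
... | false = refl
... | true = trans (sym ([]≔true-mono s i w eq)) free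

mark-mono : ∀ {n} (s : Vec Bool n) u v w → Matched s w → Matched (mark u v s) w
mark-mono s u v w = []≔true-mono (s [ u ]≔ true) v w ∘ []≔true-mono s u w

mark-free⁻ : ∀ {n} (s : Vec Bool n) u v w → Free (mark u v s) w → Free s w
mark-free⁻ s u v w = []≔true-free⁻ s u w ∘ []≔true-free⁻ (s [ u ]≔ true) v w

matchedAfter : ∀ {n} → Vec Bool n → List (Edge n) → Vec Bool n
matchedAfter s [] = s
matchedAfter s ((u , v) ∷ es) =
  if not (lookup s u) ∧ not (lookup s v) then matchedAfter (mark u v s) es else matchedAfter s es

greedyFrom-++ : ∀ {n} (s : Vec Bool n) xs ys →
  greedyFrom s (xs ++ ys) ≡ greedyFrom s xs ++ greedyFrom (matchedAfter s xs) ys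
greedyFrom-++ s [] ys = refl
greedyFrom-++ s ((u , v) ∷ xs) ys with not (lookup s u) ∧ not (lookup s v)
... | true = cong ((u , v) ∷_) (greedyFrom-++ (mark u v s) xs ys)
... | false = greedyFrom-++ s xs ys

∈-greedyFrom⁻ : ∀ {n} (s : Vec Bool n) xs {e : Edge n} → e ∈ greedyFrom s xs →
  Free s (proj₁ e) × Free s (proj₂ e) × e ∈ xs
∈-greedyFrom⁻ s ((u , v) ∷ xs) e∈ with lookup s u in u-free | lookup s v in v-free
∈-greedyFrom⁻ s ((u , v) ∷ xs) (here refl) | false | false = u-free , v-free , here refl
∈-greedyFrom⁻ s ((u , v) ∷ xs) (there e∈) | false | false
  with ∈-greedyFrom⁻ (mark u v s) xs e∈
... | free₁ , free₂ , e∈xs = mark-free⁻ s u v _ free₁ , mark-free⁻ s u v _ free₂ , there e∈xs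
∈-greedyFrom⁻ s ((u , v) ∷ xs) e∈ | false | true with ∈-greedyFrom⁻ s xs e∈
... | free₁ , free₂ , e∈xs = free₁ , free₂ , there e∈xs
∈-greedyFrom⁻ s ((u , v) ∷ xs) e∈ | true | _ with ∈-greedyFrom⁻ s xs e∈
... | free₁ , free₂ , e∈xs = free₁ , free₂ , there e∈xs

matchedAfter-mono : ∀ {n} (s : Vec Bool n) xs w → Matched s w → Matched (matchedAfter s xs) w
matchedAfter-mono s [] w matched = matched
matchedAfter-mono s ((u , v) ∷ xs) w matched with not (lookup s u) ∧ not (lookup s v)
... | true = matchedAfter-mono (mark u v s) xs w (mark-mono s u v w matched)
... | false = matchedAfter-mono s xs w matched

matchedAfter-maximal : ∀ {n} (s : Vec Bool n) xs {u v} → (u , v) ∈ xs →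
  Matched (matchedAfter s xs) u ⊎ Matched (matchedAfter s xs) v
matchedAfter-maximal s ((u , v) ∷ xs) (here refl) with lookup s u in u-matched | lookup s v in v-matched
... | false | false = inj₁ (matchedAfter-mono (mark u v s) xs u
                              ([]≔true-mono (s [ u ]≔ true) v u (lookup∘update u s true)))
... | false | true = inj₂ (matchedAfter-mono s xs v v-matched)
... | true | _ = inj₁ (matchedAfter-mono s xs u u-matched)
matchedAfter-maximal s ((u′ , v′) ∷ xs) (there uv∈) with not (lookup s u′) ∧ not (lookup s v′)
... | true = matchedAfter-maximal (mark u′ v′ s) xs uv∈
... | false = matchedAfter-maximal s xs uv∈

induced-++ : ∀ {n} (q : Query n) xs ys → induced q (xs ++ ys) ≡ induced q xs ++ induced q ys
induced-++ q [] ys = refl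
induced-++ q ((u , v) ∷ xs) ys with lookup q u ∧ lookup q v
... | true = cong ((u , v) ∷_) (induced-++ q xs ys)
... | false = induced-++ q xs ys

∈-induced⁺ : ∀ {n} (q : Query n) xs {u v} → (u , v) ∈ xs → lookup q u ≡ true → lookup q v ≡ true →
  (u , v) ∈ induced q xs
∈-induced⁺ q ((u , v) ∷ xs) (here refl) u∈q v∈q rewrite u∈q | v∈q = here refl
∈-induced⁺ q ((u′ , v′) ∷ xs) (there uv∈) u∈q v∈q with lookup q u′ ∧ lookup q v′
... | true = there (∈-induced⁺ q xs uv∈ u∈q v∈q)
... | false = ∈-induced⁺ q xs uv∈ u∈q v∈q

∈-induced⁻ : ∀ {n} (q : Query n) xs {e : Edge n} → e ∈ induced q xs →
  e ∈ xs × lookup q (proj₁ e) ≡ true × lookup q (proj₂ e) ≡ true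
∈-induced⁻ q ((u , v) ∷ xs) e∈ with lookup q u in u∈q | lookup q v in v∈q
∈-induced⁻ q ((u , v) ∷ xs) (here refl) | true | true = here refl , u∈q , v∈q
∈-induced⁻ q ((u , v) ∷ xs) (there e∈) | true | true with ∈-induced⁻ q xs e∈
... | e∈xs , in₁ , in₂ = there e∈xs , in₁ , in₂
∈-induced⁻ q ((u , v) ∷ xs) e∈ | true | false with ∈-induced⁻ q xs e∈
... | e∈xs , in₁ , in₂ = there e∈xs , in₁ , in₂
∈-induced⁻ q ((u , v) ∷ xs) e∈ | false | _ with ∈-induced⁻ q xs e∈
... | e∈xs , in₁ , in₂ = there e∈xs , in₁ , in₂

answer⊆ : ∀ {n} (π : List (Edge n)) q {e} → e ∈ answer π q → e ∈ π
answer⊆ π q = proj₁ ∘ ∈-induced⁻ q π ∘ proj₂ ∘ proj₂ ∘ ∈-greedyFrom⁻ _ (induced q π)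

AnsweredBy : ∀ {n} → List (Edge n) → History n → Set
AnsweredBy π = All (λ round → proj₂ round ≡ answer π (proj₁ round))

transcript-answeredBy : ∀ {n} (σ : Strategy n) π k → AnsweredBy π (transcript σ π k)
transcript-answeredBy σ π zero = []
transcript-answeredBy σ π (suc k) with σ (transcript σ π k)
... | just q = All.++⁺ (transcript-answeredBy σ π k) (refl ∷ [])
... | nothing = transcript-answeredBy σ π k

answeredEdges⊆ : ∀ {n} {π : List (Edge n)} {h} → AnsweredBy π h → ∀ {e} → e ∈ answeredEdges h → e ∈ π
answeredEdges⊆ {π = π} {h} answered e∈ with find (∈-concatMap⁻ proj₂ {xs = h} e∈)
... | (q , M) , round∈ , e∈M = answer⊆ π q (subst (_ ∈_) (All.lookup answered round∈) e∈M)

transcript-halted : ∀ {n} (σ : Strategy n) π k → HaltsBy σ π k →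
  ∀ d → transcript σ π (d + k) ≡ transcript σ π k
transcript-halted σ π k halts zero = refl
transcript-halted σ π k halts (suc d) rewrite transcript-halted σ π k halts d | halts = refl

transcript-stable : ∀ {n} (σ : Strategy n) π {k k′} → HaltsBy σ π k → k ≤ k′ →
  transcript σ π k′ ≡ transcript σ π k
transcript-stable σ π {k} {k′} halts k≤k′ =
  trans (cong (transcript σ π) (sym (m∸n+n≡m k≤k′))) (transcript-halted σ π k halts (k′ ∸ k))

halted-transcripts-≡ : ∀ {n} (σ : Strategy n) π k k′ → HaltsBy σ π k → HaltsBy σ π k′ →
  transcript σ π k ≡ transcript σ π k′
halted-transcripts-≡ σ π k k′ halts halts′ with ≤-total k k′
... | inj₁ k≤k′ = sym (transcript-stable σ π halts k≤k′)
... | inj₂ k′≤k = transcript-stable σ π halts′ k′≤k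

module HalfGraph (m : ℕ) where

  left right : Fin m → Fin (m * 2)
  left i = combine i Fin.zero
  right i = combine i (Fin.suc Fin.zero)

  isLeft : Fin (m * 2) → Bool
  isLeft w = toℕ (proj₂ (remQuot {m} 2 w)) ≡ᵇ 0

  colours-differ : ∀ i j → isLeft (left i) ≢ isLeft (right j)
  colours-differ i j same = not-¬ isLeft-left (trans same isLeft-right)
    where
    isLeft-left : isLeft (left i) ≡ true
    isLeft-left = cong (λ p → toℕ (proj₂ p) ≡ᵇ 0) (remQuot-combine i Fin.zero)
    isLeft-right : isLeft (right j) ≡ false
    isLeft-right = cong (λ p → toℕ (proj₂ p) ≡ᵇ 0) (remQuot-combine j (Fin.suc Fin.zero))

  left≢right : ∀ i j → left i ≢ right j
  left≢right i j = colours-differ i j ∘ cong isLeft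

  left-injective : Injective _≡_ _≡_ left
  left-injective {i} {j} = combine-injectiveˡ i Fin.zero j Fin.zero

  right-injective : Injective _≡_ _≡_ right
  right-injective {i} {j} = combine-injectiveˡ i (Fin.suc Fin.zero) j (Fin.suc Fin.zero)

  edge : Fin m × Fin m → Edge (m * 2)
  edge (i , j) = left i , right j

  diagonal : Fin m → Edge (m * 2)
  diagonal i = edge (i , i)

  edge-sameEdge⁻ : ∀ {p p′} → SameEdge (edge p) (edge p′) → p ≡ p′
  edge-sameEdge⁻ (inj₁ (same₁ , same₂)) with left-injective same₁ | right-injective same₂
  ... | refl | refl = refl
  edge-sameEdge⁻ {i , _} {_ , l} (inj₂ (crossed , _)) = ⊥-elim (left≢right i l crossed)

  below? : (p : Fin m × Fin m) → Dec (proj₂ p Fin.< proj₁ p)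
  below? p = proj₂ p <? proj₁ p

  lowerPairs diagonalPairs : List (Fin m × Fin m)
  lowerPairs = filter below? (cartesianProduct (allFin m) (allFin m))
  diagonalPairs = map (λ i → i , i) (allFin m)

  lowerEdges diagonalEdges halfGraph : List (Edge (m * 2))
  lowerEdges = map edge lowerPairs
  diagonalEdges = map edge diagonalPairs
  halfGraph = lowerEdges ++ diagonalEdges

  ∈-lowerEdges⁺ : ∀ {i j} → j Fin.< i → edge (i , j) ∈ lowerEdges
  ∈-lowerEdges⁺ {i} {j} j<i =
    ∈-map⁺ edge (∈-filter⁺ below? (∈-cartesianProduct⁺ (∈-allFin i) (∈-allFin j)) j<i)

  ∈-lowerPairs⁻ : ∀ {p} → p ∈ lowerPairs → proj₂ p Fin.< proj₁ p
  ∈-lowerPairs⁻ = proj₂ ∘ ∈-filter⁻ below? {xs = cartesianProduct (allFin m) (allFin m)}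

  ∈-lowerEdges⁻ : ∀ {e} → e ∈ lowerEdges → ∃₂ λ i j → j Fin.< i × e ≡ edge (i , j)
  ∈-lowerEdges⁻ e∈ with ∈-map⁻ edge e∈
  ... | (i , j) , p∈ , refl = i , j , ∈-lowerPairs⁻ p∈ , refl

  ∈-diagonalEdges⁺ : ∀ i → diagonal i ∈ diagonalEdges
  ∈-diagonalEdges⁺ i = ∈-map⁺ edge (∈-map⁺ (λ i → i , i) (∈-allFin i))

  ∈-diagonalEdges⁻ : ∀ {e} → e ∈ diagonalEdges → ∃ λ i → e ≡ diagonal i
  ∈-diagonalEdges⁻ e∈ with ∈-map⁻ edge e∈
  ... | _ , p∈ , refl with ∈-map⁻ (λ i → i , i) p∈
  ... | i , _ , refl = i , refl

  ∈-halfGraph⁻ : ∀ {e} → e ∈ halfGraph → ∃₂ λ i j → e ≡ edge (i , j)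
  ∈-halfGraph⁻ e∈ with ∈-++⁻ lowerEdges e∈
  ... | inj₁ e∈lower with ∈-lowerEdges⁻ e∈lower
  ...   | i , j , _ , refl = i , j , refl
  ∈-halfGraph⁻ e∈ | inj₂ e∈diagonal with ∈-diagonalEdges⁻ e∈diagonal
  ...   | i , refl = i , i , refl

  diagonal∉lowerEdges : ∀ i → diagonal i ∈ lowerEdges → ⊥
  diagonal∉lowerEdges i e∈ with ∈-lowerEdges⁻ e∈
  ... | k , l , l<k , same with left-injective (cong proj₁ same) | right-injective (cong proj₂ same)
  ... | refl | refl = <-irrefl refl l<k

  halfGraph-pairs-unique : Unique (lowerPairs ++ diagonalPairs)
  halfGraph-pairs-unique = Unique.++⁺
    (Unique.filter⁺ below? (Unique.cartesianProduct⁺ (Unique.allFin⁺ m) (Unique.allFin⁺ m)))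
    (Unique.map⁺ (cong proj₁) (Unique.allFin⁺ m))
    lower∩diagonal≡∅
    where
    lower∩diagonal≡∅ : ∀ {p} → ¬ (p ∈ lowerPairs × p ∈ diagonalPairs)
    lower∩diagonal≡∅ (p∈lower , p∈diagonal) with ∈-map⁻ (λ i → i , i) p∈diagonal
    ... | _ , _ , refl = <-irrefl refl (∈-lowerPairs⁻ p∈lower)

  halfGraph-simple : SimpleEdgeList halfGraph
  halfGraph-simple = All.tabulate no-loop ,
    subst (AllPairs _) (map-++ edge lowerPairs diagonalPairs)
      (AllPairs.map⁺ (AllPairs.map (λ p≢p′ → p≢p′ ∘ edge-sameEdge⁻) halfGraph-pairs-unique))
    where
    no-loop : ∀ {e} → e ∈ halfGraph → proj₁ e ≢ proj₂ e
    no-loop e∈ with ∈-halfGraph⁻ e∈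
    ... | i , j , refl = left≢right i j

  halfGraph-bipartite : Bipartite halfGraph
  halfGraph-bipartite = isLeft , All.tabulate proper
    where
    proper : ∀ {e} → e ∈ halfGraph → isLeft (proj₁ e) ≢ isLeft (proj₂ e)
    proper e∈ with ∈-halfGraph⁻ e∈
    ... | i , j , refl = colours-differ i j

  diagonal-perfect : PerfectMatching (m * 2) diagonalEdges
  diagonal-perfect =
    AllPairs.map⁺ (AllPairs.map⁺ (AllPairs.map diagonals-disjoint (Unique.allFin⁺ m))) , covered
    where
    diagonals-disjoint : ∀ {i j} → i ≢ j → Disjoint (diagonal i) (diagonal j)
    diagonals-disjoint {i} {j} i≢j w (inj₁ p) (inj₁ q) = i≢j (left-injective (trans (sym p) q))
    diagonals-disjoint {i} {j} i≢j w (inj₁ p) (inj₂ q) = left≢right i j (trans (sym p) q)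
    diagonals-disjoint {i} {j} i≢j w (inj₂ p) (inj₁ q) = left≢right j i (trans (sym q) p)
    diagonals-disjoint {i} {j} i≢j w (inj₂ p) (inj₂ q) = i≢j (right-injective (trans (sym p) q))

    covered : ∀ w → Any (Incident w) diagonalEdges
    covered w = lose (∈-diagonalEdges⁺ i) (incident (proj₂ (remQuot {m} 2 w)) (sym (combine-remQuot {m} 2 w)))
      where
      i = proj₁ (remQuot {m} 2 w)
      incident : ∀ s → w ≡ combine i s → Incident w (diagonal i)
      incident Fin.zero w≡ = inj₁ w≡
      incident (Fin.suc Fin.zero) w≡ = inj₂ w≡

  halfGraph-admissible : Admissible (m * 2) halfGraph
  halfGraph-admissible = halfGraph-simple , halfGraph-bipartite ,
    diagonalEdges , All.tabulate (∈-++⁺ʳ lowerEdges) , diagonal-perfect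

  module _ (q : Query (m * 2)) where

    afterLower : Vec Bool (m * 2)
    afterLower = matchedAfter (replicate (m * 2) false) (induced q lowerEdges)

    answer-split : answer halfGraph q ≡
      greedy (induced q lowerEdges) ++ greedyFrom afterLower (induced q diagonalEdges)
    answer-split = trans (cong greedy (induced-++ q lowerEdges diagonalEdges))
                         (greedyFrom-++ _ (induced q lowerEdges) (induced q diagonalEdges))

    ∈-answer-diagonal⁻ : ∀ i → diagonal i ∈ answer halfGraph q →
      Free afterLower (left i) × Free afterLower (right i) ×
      lookup q (left i) ≡ true × lookup q (right i) ≡ true
    ∈-answer-diagonal⁻ i i∈ with ∈-++⁻ (greedy (induced q lowerEdges)) (subst (_ ∈_) answer-split i∈)
    ... | inj₁ i∈lower = ⊥-elim (diagonal∉lowerEdges i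
            (proj₁ (∈-induced⁻ q lowerEdges (proj₂ (proj₂ (∈-greedyFrom⁻ _ _ i∈lower))))))
    ... | inj₂ i∈diagonal with ∈-greedyFrom⁻ afterLower (induced q diagonalEdges) i∈diagonal
    ...   | left-free , right-free , i∈induced with ∈-induced⁻ q diagonalEdges i∈induced
    ...   | _ , left∈q , right∈q = left-free , right-free , left∈q , right∈q

    answer-diagonal-< : ∀ {i j} → i Fin.< j →
      diagonal i ∈ answer halfGraph q → diagonal j ∈ answer halfGraph q → ⊥
    answer-diagonal-< {i} {j} i<j i∈ j∈
      with ∈-answer-diagonal⁻ i i∈ | ∈-answer-diagonal⁻ j j∈
    ... | _ , right-i-free , _ , right-i∈q | left-j-free , _ , left-j∈q , _
      with matchedAfter-maximal _ (induced q lowerEdges)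
             (∈-induced⁺ q lowerEdges (∈-lowerEdges⁺ i<j) left-j∈q right-i∈q)
    ... | inj₁ left-j-matched = not-¬ left-j-matched left-j-free
    ... | inj₂ right-i-matched = not-¬ right-i-matched right-i-free

  answer-diagonal-unique : ∀ q {i j} →
    diagonal i ∈ answer halfGraph q → diagonal j ∈ answer halfGraph q → i ≡ j
  answer-diagonal-unique q {i} {j} i∈ j∈ with <-cmp i j
  ... | tri< i<j _ _ = ⊥-elim (answer-diagonal-< q i<j i∈ j∈)
  ... | tri≈ _ i≡j _ = i≡j
  ... | tri> _ _ j<i = ⊥-elim (answer-diagonal-< q j<i j∈ i∈)

  -- Strong induction on i: left i lies on some (left i , right j) ∈ M with j ≤ i, and
  -- j < i is impossible since right j is already covered by diagonal j ∈ M.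
  diagonal⊆perfectMatching : ∀ {M} → All (_∈ halfGraph) M → PerfectMatching (m * 2) M →
    ∀ i → diagonal i ∈ M
  diagonal⊆perfectMatching {M} M⊆ (disjoint , covers) i = go i (<-wellFounded i)
    where
    go : ∀ i → Acc Fin._<_ i → diagonal i ∈ M
    go i (acc smaller) with find (covers (left i))
    ... | e , e∈M , left-i∈e with ∈-++⁻ lowerEdges (All.lookup M⊆ e∈M)
    ... | inj₂ e∈diagonal with ∈-diagonalEdges⁻ e∈diagonal
    ...   | k , refl with left-i∈e
    ...   | inj₂ left≡right = ⊥-elim (left≢right i k left≡right)
    ...   | inj₁ left≡left with left-injective left≡left
    ...   | refl = e∈M
    go i (acc smaller) | e , e∈M , left-i∈e | inj₁ e∈lower with ∈-lowerEdges⁻ e∈lower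
    ...   | k , j , j<k , refl with left-i∈e
    ...   | inj₂ left≡right = ⊥-elim (left≢right i j left≡right)
    ...   | inj₁ left≡left with left-injective left≡left
    ...   | refl with allPairs-∈ Disjoint-sym disjoint e∈M (go j (smaller j<k))
    ...   | inj₁ same = ⊥-elim (<-irrefl (sym (left-injective (cong proj₁ same))) j<k)
    ...   | inj₂ apart = ⊥-elim (apart (right j) (inj₂ refl) (inj₂ refl))

  rounds-≥ : ∀ {h} → AnsweredBy halfGraph h → ContainsPM (m * 2) (answeredEdges h) → m ≤ length h
  rounds-≥ {h} answered (M , M⊆ , perfect) =
    ≤-length-concatMap proj₂ h diagonal diagonal-answered separated
    where
    diagonal-answered : ∀ i → diagonal i ∈ answeredEdges h
    diagonal-answered i =
      All.lookup M⊆ (diagonal⊆perfectMatching (All.map (answeredEdges⊆ answered) M⊆) perfect i)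

    separated : ∀ {round} → round ∈ h → ∀ i j →
      diagonal i ∈ proj₂ round → diagonal j ∈ proj₂ round → i ≡ j
    separated {q , _} round∈ i j i∈ j∈ rewrite All.lookup answered round∈ =
      answer-diagonal-unique q i∈ j∈

mainTheorem4 : ∀ (n : ℕ) → 2 ∣ n → (σ : Strategy n) → AlwaysCorrect n σ →
    Σ (List (Edge n)) λ π → Admissible n π ×
      (∀ k → HaltsBy σ π k → n / 2 ≤ length (transcript σ π k))
mainTheorem4 .(m * 2) (divides m refl) σ correct = halfGraph , halfGraph-admissible , rounds
  where
  open HalfGraph m
  rounds : ∀ k → HaltsBy σ halfGraph k → (m * 2) / 2 ≤ length (transcript σ halfGraph k)
  rounds k halts with correct halfGraph halfGraph-admissible
  ... | k′ , halts′ , found = begin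
    (m * 2) / 2                           ≡⟨ m*n/n≡m m 2 ⟩
    m                                     ≤⟨ rounds-≥ (transcript-answeredBy σ halfGraph k′) found ⟩
    length (transcript σ halfGraph k′)    ≡⟨ cong length (halted-transcripts-≡ σ halfGraph k′ k halts′ halts) ⟩
    length (transcript σ halfGraph k)     ∎
    where open ≤-Reasoning
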